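{- Let $C$ be a closure system on an ordered set $(S,\leq)$, and let $S'$ be an isolated suborder of $(S,\leq)$ with greatest element $\top_{S'}$ and least element $\bot_{S'}$. Then $C\cap S'$ is a preclosure system of $(S',\leq|_{S'})$. Moreover, if $S'$ is a summit isolated suborder, then $C\cap S'$ is a closure system of $(S',\leq|_{S'})$.
   Context: A subset $C$ of an ordered set $(P,\preceq)$ is a closure system if for every $p\in P$ the set $\{y\in C\mid p\preceq y\}$ has a least element. If $(P,\preceq)$ has a greatest element $\top$, a subset $C\subseteq P$ is a preclosure system if $C\cup\{\top\}$ is a closure system. A subset $S'\subseteq S$ is an isolated suborder if (1) $S'$ has a greatest element $\top_{S'}$ and a least element $\bot_{S'}$; (2) for all $x\notin S'$ and $y'\in S'$, $y'\leq x$ implies $\top_{S'}\leq x$; (3) for all $x\notin S'$ and $y'\in S'$, $x\leq y'$ implies $x\leq\bot_{S'}$. It is a summit isolated suborder if $\top_{S'}$ is a maximal element of $S$. -}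

module Defs where

open import Level using (Level; _⊔_)
open import Data.Product using (Σ; ∃; _×_; _,_; proj₁)
open import Data.Sum using (_⊎_)
open import Relation.Binary.Core using (Rel)
open import Relation.Binary.PropositionalEquality using (_≡_)
open import Relation.Unary using (Pred; _∈_; _∉_)

module _ {x ℓ : Level} {X : Set x} (_≼_ : Rel X ℓ) where

  IsLeast : ∀ {r} → Pred X r → X → Set (x ⊔ ℓ ⊔ r)
  IsLeast Y m = m ∈ Y × (∀ y → y ∈ Y → m ≼ y)

  IsGreatest : ∀ {r} → Pred X r → X → Set (x ⊔ ℓ ⊔ r)
  IsGreatest Y m = m ∈ Y × (∀ y → y ∈ Y → y ≼ m)

  UpIn : ∀ {r} → Pred X r → X → Pred X (ℓ ⊔ r)
  UpIn C p y = y ∈ C × p ≼ y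

  IsClosureSystem : ∀ {r} → Pred X r → Set (x ⊔ ℓ ⊔ r)
  IsClosureSystem C = ∀ p → ∃ λ m → IsLeast (UpIn C p) m

  IsPreclosureSystem : ∀ {e r} → Rel X e → Pred X r → Set (x ⊔ ℓ ⊔ e ⊔ r)
  IsPreclosureSystem _≈_ C =
    Σ X λ ⊤ → (∀ y → y ≼ ⊤) × IsClosureSystem (λ y → y ∈ C ⊎ y ≈ ⊤)

module _ {a ℓ : Level} {A : Set a} (_≤_ : Rel A ℓ) where

  IsMaximal : A → Set (a ⊔ ℓ)
  IsMaximal m = ∀ y → m ≤ y → y ≡ m

  record IsolatedSuborder {s} (S' : Pred A s) : Set (a ⊔ ℓ ⊔ s) where
    field
      ⊤' : A
      ⊥' : A
      ⊤'-greatest : IsGreatest _≤_ S' ⊤'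
      ⊥'-least    : IsLeast _≤_ S' ⊥'
      above : ∀ x y' → x ∉ S' → y' ∈ S' → y' ≤ x → ⊤' ≤ x
      below : ∀ x y' → x ∉ S' → y' ∈ S' → x ≤ y' → x ≤ ⊥'

  IsSummit : ∀ {s} {S' : Pred A s} → IsolatedSuborder S' → Set (a ⊔ ℓ)
  IsSummit iso = IsMaximal (IsolatedSuborder.⊤' iso)

  Sub : ∀ {s} → Pred A s → Set (a ⊔ s)
  Sub S' = Σ A λ y → y ∈ S'

  _≤|_ : ∀ {s} {S' : Pred A s} → Rel (Sub S') ℓ
  u ≤| v = proj₁ u ≤ proj₁ v

  _≡|_ : ∀ {s} {S' : Pred A s} → Rel (Sub S') a
  u ≡| v = proj₁ u ≡ proj₁ v

  Restrict : ∀ {r s} (S' : Pred A s) → Pred A r → Pred (Sub S') r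
  Restrict S' C u = proj₁ u ∈ C

{-# OPTIONS --safe #-}
module Submission where

open import Defs
open import Level using (Level; _⊔_)
open import Data.Product using (_×_; _,_; proj₁; proj₂)
open import Data.Sum using (_⊎_; inj₁; inj₂)
open import Relation.Binary.Core using (Rel)
open import Relation.Binary.Structures using (IsPartialOrder)
open import Relation.Binary.PropositionalEquality using (_≡_; refl; sym; subst)
open import Relation.Unary using (Pred; _∈_; _∉_)
open import Relation.Nullary using (¬_; yes; no)
open import Relation.Nullary.Decidable using (decidable-stable)
open import Axiom.ExcludedMiddle using (ExcludedMiddle)

-- For p ∈ S', let m be the C-closure of p in S. If m ∈ S', it is also the
-- closure of p in C ∩ S'. Otherwise isolation forces ⊤_{S'} ≤ m, so ⊤_{S'}
-- lies below every element of C ∩ S' above p and is the closure of p in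
-- (C ∩ S') ∪ {⊤_{S'}}. When ⊤_{S'} is maximal, ⊤_{S'} ≤ m gives m = ⊤_{S'} ∈ S',
-- so the second case cannot occur.

module Restriction {a ℓ r s : Level} {A : Set a} {_≤_ : Rel A ℓ} (C : Pred A r) (S' : Pred A s) where

  C' : Pred (Sub _≤_ S') r
  C' = Restrict _≤_ S' C

  least-restrict : ∀ {p m} (pS : p ∈ S') (mS : m ∈ S')
    → IsLeast _≤_ (UpIn _≤_ C p) m
    → IsLeast (_≤|_ _≤_) (UpIn (_≤|_ _≤_) C' (p , pS)) (m , mS)
  least-restrict pS mS ((mC , p≤m) , least) =
    (mC , p≤m) , λ (y , _) (yC , p≤y) → least y (yC , p≤y)

  module Isolated (po : IsPartialOrder _≡_ _≤_) (iso : IsolatedSuborder _≤_ S') where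

    open IsPartialOrder po using (trans; reflexive)
    open IsolatedSuborder iso

    top' : Sub _≤_ S'
    top' = ⊤' , proj₁ ⊤'-greatest

    top'-greatest : ∀ u → _≤|_ _≤_ u top'
    top'-greatest (y , yS) = proj₂ ⊤'-greatest y yS

    C'∪top' : Pred (Sub _≤_ S') (a ⊔ r)
    C'∪top' u = u ∈ C' ⊎ _≡|_ _≤_ u top'

    least-adjoin-top' : ∀ {p m}
      → IsLeast (_≤|_ _≤_) (UpIn (_≤|_ _≤_) C' p) m
      → IsLeast (_≤|_ _≤_) (UpIn (_≤|_ _≤_) C'∪top' p) m
    least-adjoin-top' {m = m} ((mC , p≤m) , least) = (inj₁ mC , p≤m) , λ where
      u (inj₁ uC , p≤u) → least u (uC , p≤u)
      (_ , _) (inj₂ refl , _) → top'-greatest m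

    top'-least-when-closure-escapes : ∀ {p m} (pS : p ∈ S') → m ∉ S'
      → IsLeast _≤_ (UpIn _≤_ C p) m
      → IsLeast (_≤|_ _≤_) (UpIn (_≤|_ _≤_) C'∪top' (p , pS)) top'
    top'-least-when-closure-escapes {p} {m} pS mS ((_ , p≤m) , least) =
      (inj₂ refl , top'-greatest (p , pS)) , λ where
        (y , _) (inj₁ yC , p≤y) → trans (above m p mS pS p≤m) (least y (yC , p≤y))
        (_ , _) (inj₂ refl , _) → reflexive refl

    summit-closure-not-outside : IsSummit _≤_ iso → ∀ {p m} → p ∈ S' → p ≤ m → ¬ m ∉ S'
    summit-closure-not-outside maximal {p} {m} pS p≤m mS =
      mS (subst S' (sym (maximal m (above m p mS pS p≤m))) (proj₁ ⊤'-greatest))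

lemma5p4 : ∀ {a ℓ r s : Level} {A : Set a} {_≤_ : Rel A ℓ}
    → ExcludedMiddle s
    → IsPartialOrder _≡_ _≤_
    → (C : Pred A r) (S' : Pred A s)
    → IsClosureSystem _≤_ C
    → (iso : IsolatedSuborder _≤_ S')
    → IsPreclosureSystem (_≤|_ _≤_ {S' = S'}) (_≡|_ _≤_ {S' = S'}) (Restrict _≤_ S' C)
      × (IsSummit _≤_ iso → IsClosureSystem (_≤|_ _≤_ {S' = S'}) (Restrict _≤_ S' C))
lemma5p4 {_≤_ = _≤_} em po C S' closure iso =
  (top' , top'-greatest , preclosure) , summit
  where
  open Restriction C S'
  open Isolated po iso

  preclosure : IsClosureSystem (_≤|_ _≤_) C'∪top'
  preclosure (p , pS) with closure p
  ... | m , m-least with em {S' m}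
  ... | yes mS = (m , mS) , least-adjoin-top' {p , pS} {m , mS} (least-restrict pS mS m-least)
  ... | no mS = top' , top'-least-when-closure-escapes pS mS m-least

  summit : IsSummit _≤_ iso → IsClosureSystem (_≤|_ _≤_) C'
  summit maximal (p , pS) with closure p
  ... | m , m-least@((_ , p≤m) , _) =
    let mS = decidable-stable em (summit-closure-not-outside maximal pS p≤m)
    in (m , mS) , least-restrict pS mS m-least
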